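{- Let $M$ be a finite semilattice with separated equalizers, and suppose $a,b,c,d\in M$ satisfy $a\mid b$, $a\mid c$, $c\mid d$, and $bc=bd$. Then there exists $x\in M$ with $a\mid x$ and $x\mid b$ such that either $xc=d$, or $xc$ and $d$ are incomparable (neither divides the other).
   Context: A semilattice here is a commutative monoid (written multiplicatively, with identity) in which every element satisfies $x^2=x$; $x\mid y$ means $xz=y$ for some $z$. An equalizing pair is a pair $x,y$ with $x\mid y$ for which there exist $a,b$ with $xa\neq xb$, $xa\neq ya$, $ya=yb$, and $yb\neq xb$. A finite semilattice has separated equalizers if for each equalizing pair $x,y$ there exists $z$ with $x\mid z$, $z\mid y$, $z\neq x$, $z\neq y$. -}

module Defs where

open import Level using (Level; suc; _⊔_)
open import Data.Nat using (ℕ)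
open import Data.Fin using (Fin)
open import Data.Product using (Σ; ∃; ∃-syntax; _×_; _,_)
open import Relation.Nullary using (¬_)
open import Relation.Binary.PropositionalEquality using (_≡_; _≢_)
open import Function.Bundles using (_↔_)
open import Algebra.Structures using (IsCommutativeMonoid)

record Semilattice (c : Level) : Set (suc c) where
  field
    Carrier : Set c
    _∙_     : Carrier → Carrier → Carrier
    ε       : Carrier
    isCommutativeMonoid : IsCommutativeMonoid _≡_ _∙_ ε
    idem    : ∀ x → x ∙ x ≡ x

  infixl 7 _∙_
  infix 4 _∣_

  _∣_ : Carrier → Carrier → Set c
  x ∣ y = ∃[ z ] (x ∙ z ≡ y)

  EqualizingPair : Carrier → Carrier → Set c
  EqualizingPair x y =
    x ∣ y × ∃[ a ] ∃[ b ] (x ∙ a ≢ x ∙ b × x ∙ a ≢ y ∙ a × y ∙ a ≡ y ∙ b × y ∙ b ≢ x ∙ b)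

  SeparatedEqualizers : Set c
  SeparatedEqualizers =
    ∀ x y → EqualizingPair x y → ∃[ z ] (x ∣ z × z ∣ y × z ≢ x × z ≢ y)

Finite : ∀ {c} → Semilattice c → Set c
Finite M = ∃[ n ] (Semilattice.Carrier M ↔ Fin n)

-- If c′ equals d or b c′ equals d we are done; otherwise the interval from a to b
-- straddles d: a c′ = c′ lies strictly below d and d lies strictly below b c′
-- (as b c′ = b d).  Whenever y ∣ x and y c′ < d < x c′, the pair (y, x) is
-- equalizing (witnessed by c′ and d), so separated equalizers give a z strictly
-- between y and x.  Either z c′ = d, or z c′ is incomparable to d, or z c′ lies
-- strictly on one side of d and the strictly smaller interval (y, z) or (z, x)
-- straddles d again.  Finiteness makes this shrinking terminate.
module Submission where

open import Defs
open import Data.Fin using (Fin)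
import Data.Fin.Properties as Fin
open import Data.Fin.Induction using (spo-wellFounded)
open import Data.Product using (∃-syntax; _×_; _,_; proj₂)
open import Data.Product.Relation.Binary.Lex.Strict using (×-Lex; ×-wellFounded)
open import Data.Sum using (_⊎_; inj₁; inj₂)
open import Function.Base using (flip; _on_)
open import Function.Bundles using (_↔_; Inverse)
open import Function.Properties.Inverse using (↔⇒↣)
open import Induction.WellFounded using (WellFounded; module Subrelation; module All)
open import Relation.Binary.Core using (Rel)
open import Relation.Binary.Definitions using (DecidableEquality)
open import Relation.Binary.Structures using (IsStrictPartialOrder)
import Relation.Binary.Construct.On as On
import Relation.Binary.Construct.Flip.EqAndOrd as Flip
open import Relation.Nullary using (¬_; Dec; yes; no)
open import Relation.Nullary.Decidable using (via-injection; map′)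
open import Relation.Binary.PropositionalEquality
open import Algebra.Structures using (IsCommutativeMonoid)

module _ {a n} {A : Set a} (A↔Fin : A ↔ Fin n) where
  open Inverse A↔Fin

  ↔Fin⇒≟ : DecidableEquality A
  ↔Fin⇒≟ = via-injection (↔⇒↣ A↔Fin) Fin._≟_

  ↔Fin⇒spo-wellFounded : ∀ {r} {_<_ : Rel A r} →
    IsStrictPartialOrder _≡_ _<_ → WellFounded _<_
  ↔Fin⇒spo-wellFounded {_<_ = _<_} spo =
    Subrelation.wellFounded <⇒<ᶠ
      (On.wellFounded to (spo-wellFounded (On.isStrictPartialOrder from spo)))
    where
    <⇒<ᶠ : ∀ {x y} → x < y → ((_<_ on from) on to) x y
    <⇒<ᶠ {x} {y} = subst₂ _<_ (sym (strictlyInverseʳ x)) (sym (strictlyInverseʳ y))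

module Divisibility {ℓ} (M : Semilattice ℓ) where
  open Semilattice M
  open IsCommutativeMonoid isCommutativeMonoid using (assoc; comm)

  ∣⇒∙≡ : ∀ {x y} → x ∣ y → x ∙ y ≡ y
  ∣⇒∙≡ {x} (z , refl) = trans (sym (assoc x x z)) (cong (_∙ z) (idem x))

  ∣⇒∙≡′ : ∀ {x y} → x ∣ y → y ∙ x ≡ y
  ∣⇒∙≡′ {x} {y} x∣y = trans (comm y x) (∣⇒∙≡ x∣y)

  ∣-refl : ∀ {x} → x ∣ x
  ∣-refl {x} = x , idem x

  ∣-trans : ∀ {x y z} → x ∣ y → y ∣ z → x ∣ z
  ∣-trans {x} (u , refl) (v , refl) = u ∙ v , sym (assoc x u v)

  ∣-antisym : ∀ {x y} → x ∣ y → y ∣ x → x ≡ y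
  ∣-antisym {x} {y} x∣y y∣x = trans (sym (∣⇒∙≡ y∣x)) (trans (comm y x) (∣⇒∙≡ x∣y))

  x∣x∙y : ∀ x y → x ∣ x ∙ y
  x∣x∙y x y = y , refl

  ∣? : DecidableEquality Carrier → ∀ x y → Dec (x ∣ y)
  ∣? _≟_ x y = map′ (y ,_) ∣⇒∙≡ ((x ∙ y) ≟ y)

  infix 4 _⊲_
  _⊲_ : Rel Carrier ℓ
  x ⊲ y = x ∣ y × x ≢ y

  ⊲-isStrictPartialOrder : IsStrictPartialOrder _≡_ _⊲_
  ⊲-isStrictPartialOrder = record
    { isEquivalence = isEquivalence
    ; irrefl        = λ { refl (_ , x≢x) → x≢x refl }
    ; trans         = λ { (x∣y , x≢y) (y∣z , _) →
                            ∣-trans x∣y y∣z , λ { refl → x≢y (∣-antisym x∣y y∣z) } }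
    ; <-resp-≈      = (λ { refl x⊲y → x⊲y }) , (λ { refl x⊲y → x⊲y })
    }

  data Comparison (x y : Carrier) : Set ℓ where
    equal        : x ≡ y → Comparison x y
    below        : x ⊲ y → Comparison x y
    above        : y ⊲ x → Comparison x y
    incomparable : ¬ x ∣ y → ¬ y ∣ x → Comparison x y

  compare : DecidableEquality Carrier → ∀ x y → Comparison x y
  compare _≟_ x y with x ≟ y | ∣? _≟_ x y | ∣? _≟_ y x
  ... | yes x≡y | _       | _       = equal x≡y
  ... | no x≢y  | yes x∣y | _       = below (x∣y , x≢y)
  ... | no x≢y  | no _    | yes y∣x = above (y∣x , λ y≡x → x≢y (sym y≡x))
  ... | no _    | no x∤y  | no y∤x  = incomparable x∤y y∤x

module Straddling {ℓ} (M : Semilattice ℓ) (fin : Finite M)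
                  (separated : Semilattice.SeparatedEqualizers M)
                  {c d : Semilattice.Carrier M} (c∣d : Semilattice._∣_ M c d) where
  open Semilattice M
  open IsCommutativeMonoid isCommutativeMonoid using (assoc; comm)
  open Divisibility M

  _≟_ : DecidableEquality Carrier
  _≟_ = ↔Fin⇒≟ (proj₂ fin)

  HitsBetween : Carrier → Carrier → Set ℓ
  HitsBetween y x = ∃[ z ] (y ∣ z × z ∣ x × (z ∙ c ≡ d ⊎ (¬ (z ∙ c ∣ d) × ¬ (d ∣ z ∙ c))))

  HitsBetween-widen : ∀ {y y′ x′ x} → y ∣ y′ → x′ ∣ x → HitsBetween y′ x′ → HitsBetween y x
  HitsBetween-widen y∣y′ x′∣x (z , y′∣z , z∣x′ , hit) = z , ∣-trans y∣y′ y′∣z , ∣-trans z∣x′ x′∣x , hit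

  Straddles : Carrier → Carrier → Set ℓ
  Straddles y x = y ∣ x × y ∙ c ⊲ d × d ⊲ x ∙ c

  straddles⇒equalizingPair : ∀ {y x} → Straddles y x → EqualizingPair y x
  straddles⇒equalizingPair {y} {x} (y∣x , (yc∣d , yc≢d) , (d∣xc , d≢xc)) =
    y∣x , c , d , (λ yc≡yd → yc≢d (trans yc≡yd yd≡d))
                , (λ yc≡xc → d≢xc (∣-antisym d∣xc (subst (_∣ d) yc≡xc yc∣d)))
                , sym xd≡xc
                , (λ xd≡yd → d≢xc (sym (trans (sym xd≡xc) (trans xd≡yd yd≡d))))
    where
    yd≡d : y ∙ d ≡ d
    yd≡d = ∣⇒∙≡ (∣-trans (x∣x∙y y c) yc∣d)
    xd≡xc : x ∙ d ≡ x ∙ c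
    xd≡xc = begin
      x ∙ d        ≡⟨ cong (x ∙_) (∣⇒∙≡ c∣d) ⟨
      x ∙ (c ∙ d)  ≡⟨ assoc x c d ⟨
      x ∙ c ∙ d    ≡⟨ ∣⇒∙≡′ d∣xc ⟩
      x ∙ c        ∎
      where open ≡-Reasoning

  _⋖_ : Rel (Carrier × Carrier) ℓ
  _⋖_ = ×-Lex _≡_ _⊲_ (flip _⊲_)

  ⋖-wellFounded : WellFounded _⋖_
  ⋖-wellFounded = ×-wellFounded (wf ⊲-isStrictPartialOrder)
                                (wf (Flip.isStrictPartialOrder ⊲-isStrictPartialOrder))
    where
    wf : ∀ {r} {_<_ : Rel Carrier r} → IsStrictPartialOrder _≡_ _<_ → WellFounded _<_
    wf = ↔Fin⇒spo-wellFounded (proj₂ fin)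

  straddles⇒hitsBetween : ∀ {y x} → Straddles y x → HitsBetween y x
  straddles⇒hitsBetween {y} {x} = All.wfRec ⋖-wellFounded ℓ P shrink (x , y)
    where
    P : Carrier × Carrier → Set ℓ
    P (x , y) = Straddles y x → HitsBetween y x

    shrink : ∀ xy → (∀ {xy′} → xy′ ⋖ xy → P xy′) → P xy
    shrink (x , y) rec s@(y∣x , y⊲d , d⊲x)
      with separated y x (straddles⇒equalizingPair s)
    ... | z , y∣z , z∣x , z≢y , z≢x with compare _≟_ (z ∙ c) d
    ... | equal zc≡d = z , y∣z , z∣x , inj₁ zc≡d
    ... | incomparable zc∤d d∤zc = z , y∣z , z∣x , inj₂ (zc∤d , d∤zc)
    ... | below z⊲d = HitsBetween-widen y∣z ∣-refl
                        (rec (inj₂ (refl , (y∣z , λ y≡z → z≢y (sym y≡z)))) (z∣x , z⊲d , d⊲x))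
    ... | above d⊲z = HitsBetween-widen ∣-refl z∣x
                        (rec (inj₁ (z∣x , z≢x)) (y∣z , y⊲d , d⊲z))

  hitsBetween : ∀ {a b} → a ∣ b → a ∣ c → b ∙ c ≡ b ∙ d → HitsBetween a b
  hitsBetween {a} {b} a∣b a∣c bc≡bd with c ≟ d | (b ∙ c) ≟ d
  ... | yes c≡d | _        = a , ∣-refl , a∣b , inj₁ (trans (∣⇒∙≡ a∣c) c≡d)
  ... | no _    | yes bc≡d = b , a∣b , ∣-refl , inj₁ bc≡d
  ... | no c≢d  | no bc≢d  = straddles⇒hitsBetween (a∣b , ac⊲d , d⊲bc)
    where
    ac≡c : a ∙ c ≡ c
    ac≡c = ∣⇒∙≡ a∣c
    ac⊲d : a ∙ c ⊲ d
    ac⊲d = subst (_∣ d) (sym ac≡c) c∣d , λ ac≡d → c≢d (trans (sym ac≡c) ac≡d)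
    d⊲bc : d ⊲ b ∙ c
    d⊲bc = (b , trans (comm d b) (sym bc≡bd)) , λ d≡bc → bc≢d (sym d≡bc)

mainTheorem12 : ∀ {c} (M : Semilattice c) → Finite M →
    Semilattice.SeparatedEqualizers M →
    let open Semilattice M in
    ∀ a b c′ d → a ∣ b → a ∣ c′ → c′ ∣ d → b ∙ c′ ≡ b ∙ d →
    ∃[ x ] (a ∣ x × x ∣ b × (x ∙ c′ ≡ d ⊎ (¬ (x ∙ c′ ∣ d) × ¬ (d ∣ x ∙ c′))))
mainTheorem12 M fin separated a b c′ d a∣b a∣c′ c′∣d =
  Straddling.hitsBetween M fin separated c′∣d a∣b a∣c′
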